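{- For all integers $n\ge 0$ and $c\ge 2$, and any two distinct colors $a\neq b$ in $\{1,\dots,c\}$, $$\left|\Pi_n^{eq}\wr C_c(1^a1^a)\right|=\left|\Pi_n^{eq}\wr C_c(1^a1^b)\right|.$$
   Context: $\Pi_n\wr C_c$ denotes the set of colored set partitions of $[n]$: pairs consisting of a set partition of $[n]$ (a collection of disjoint nonempty blocks with union $[n]$) and an assignment of a color in $\{1,\dots,c\}$ to each element. A colored partition eq-contains $1^a1^a$ if some block contains two elements $x<y$ both colored $a$; it eq-contains $1^a1^b$ if some block contains elements $x<y$ with $x$ colored $a$ and $y$ colored $b$. $\Pi_n^{eq}\wr C_c(P)$ is the set of elements of $\Pi_n\wr C_c$ that do not eq-contain $P$. -}

module Defs where

open import Data.Bool using (Bool; true; false; _∧_; _∨_; not; if_then_else_)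
open import Data.Nat using (ℕ; zero; suc)
open import Data.Fin using (Fin; zero; suc; _<?_)
open import Data.Fin.Properties using (_≟_)
open import Data.List using (List; []; _∷_; map; concatMap; allFin; filter; length)
open import Data.Bool.ListAction using (all; any)
open import Relation.Nullary.Decidable using (⌊_⌋)
open import Function using (_∘_)

cons : ∀ {A : Set} {n : ℕ} → A → (Fin n → A) → (Fin (suc n) → A)
cons x f zero    = x
cons x f (suc i) = f i

funs : ∀ {A : Set} → List A → (n : ℕ) → List (Fin n → A)
funs xs zero    = (λ ()) ∷ []
funs xs (suc n) = concatMap (λ x → map (cons x) (funs xs n)) xs

bools : List Bool
bools = true ∷ false ∷ []

Rel : ℕ → Set
Rel n = Fin n → Fin n → Bool

allRels : (n : ℕ) → List (Rel n)
allRels n = funs (funs bools n) n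

_⇒ᵇ_ : Bool → Bool → Bool
x ⇒ᵇ y = not x ∨ y

-- R is an equivalence relation (= a set partition of [n]; blocks = classes).
isEquivᵇ : ∀ {n} → Rel n → Bool
isEquivᵇ {n} R =
  all (λ i → R i i) (allFin n) ∧
  all (λ i → all (λ j → R i j ⇒ᵇ R j i) (allFin n)) (allFin n) ∧
  all (λ i → all (λ j → all (λ k → (R i j ∧ R j k) ⇒ᵇ R i k) (allFin n)) (allFin n)) (allFin n)

-- A colored set partition of [n] with c colors: a partition (equivalence
-- relation) together with a coloring Fin n → Fin c (colors 1..c ↦ Fin c).
record ColPart (n c : ℕ) : Set where
  constructor colpart
  field
    rel   : Rel n
    color : Fin n → Fin c
open ColPart public

-- Enumeration of Π_n ≀ C_c (every colored set partition appears exactly once).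
allColParts : (n c : ℕ) → List (ColPart n c)
allColParts n c =
  concatMap (λ R → map (colpart R) (funs (allFin c) n))
            (filter (λ R → isEquivᵇ R Data.Bool.≟ true) (allRels n))

-- eq-contains 1^a 1^b: some block contains x < y with x colored a, y colored b.
-- (eq-containing 1^a 1^a is the case b = a.)
eqContains11ᵇ : ∀ {n c} → Fin c → Fin c → ColPart n c → Bool
eqContains11ᵇ {n} a b π =
  any (λ x → any (λ y → ⌊ x <? y ⌋ ∧ rel π x y ∧ ⌊ color π x ≟ a ⌋ ∧ ⌊ color π y ≟ b ⌋)
                 (allFin n))
      (allFin n)

-- |Π_n^eq ≀ C_c(1^a 1^b)| : number of colored set partitions avoiding 1^a 1^b.
avoidCount : (n c : ℕ) → Fin c → Fin c → ℕ
avoidCount n c a b =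
  length (filter (λ π → eqContains11ᵇ a b π Data.Bool.≟ false) (allColParts n c))

module Submission where

-- Fix the underlying set partition of [n], seen as a transitive relation R, and let
-- only the coloring vary.  Call a position y *witnessed* when some x < y in the block
-- of y has color a.  The map `recolor` applies the transposition (a b) to the color
-- of every witnessed position and keeps the other colors.  The first a-colored
-- element of a block is never witnessed, so recoloring does not change which
-- positions are witnessed; hence `recolor` is an involution, and a coloring
-- eq-contains 1^a1^a exactly when its recoloring eq-contains 1^a1^b.  For every
-- partition, the colorings avoiding 1^a1^a therefore correspond to those avoiding
-- 1^a1^b, and summing over partitions gives the theorem.
--
-- The argument never uses 2 ≤ c or a ≢ b (for a = b the claim is trivial).

open import Defs
open import Data.Nat using (ℕ; _≤_)
open import Data.Fin using (Fin)
open import Relation.Binary.PropositionalEquality using (_≡_; _≢_)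

open import Level using (0ℓ)
open import Data.Bool using (Bool; true; false; T; _∧_; _∨_; not; if_then_else_)
open import Data.Bool.Properties using (T?; T-∧; T-≡)
import Data.Bool as Bool
open import Data.Bool.ListAction using (all; any; or)
open import Data.Nat using (zero; suc; _+_; _*_)
open import Data.Nat.Properties using (*-identityˡ; *-identityʳ; *-zeroʳ; *-distribˡ-+; +-assoc; +-commutativeSemigroup)
open import Algebra.Properties.CommutativeSemigroup +-commutativeSemigroup using (interchange)
open import Data.Fin using (zero; suc; _<_; _<?_)
open import Data.Fin.Properties using (_≟_; any?; all?; ∀-cons-⇔; <-trans)
open import Data.Fin.Induction using (<-wellFounded)
open import Data.Fin.Permutation.Components using (transpose; transpose-inverse)
open import Data.List using (List; []; _∷_; _++_; map; concatMap; filter; length; tabulate; allFin)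
open import Data.List.Properties using (map-tabulate; map-cong)
open import Data.List.Relation.Unary.All as All using (All; []; _∷_; universal)
open import Data.List.Relation.Unary.All.Properties using (all⁺; all-filter)
open import Data.List.Membership.Propositional.Properties using (∈-allFin)
open import Data.Product using (∃; ∃₂; _×_; _,_; proj₂)
open import Data.Empty using (⊥-elim)
open import Data.Sum using (inj₁; inj₂)
open import Function using (_∘_; id; _⇔_; mk⇔; Equivalence)
open import Induction.WellFounded using (Acc; acc)
open import Relation.Binary using (Setoid; Decidable; DecidableEquality; _Preserves_⟶_)
open import Relation.Binary.PropositionalEquality using (refl; sym; trans; cong; cong₂; subst; _≗_; _→-setoid_; module ≡-Reasoning)
open import Relation.Nullary using (¬_; Dec; yes; no; does)
open import Relation.Nullary.Decidable using (⌊_⌋; toSum; _×-dec_; dec-true; dec-false; does-⇔; isYes≗does)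

open Equivalence using (to; from)
open import Function.Properties.Equivalence using () renaming (sym to ⇔-sym)

∑ : {A : Set} → List A → (A → ℕ) → ℕ
∑ []       k = 0
∑ (x ∷ xs) k = k x + ∑ xs k

infix 5 ∑
syntax ∑ L (λ x → e) = ∑[ x ∈ L ] e

χ : Bool → ℕ
χ true  = 1
χ false = 0

χ-∧ : ∀ x y → χ (x ∧ y) ≡ χ x * χ y
χ-∧ true  y = sym (*-identityˡ (χ y))
χ-∧ false y = refl

private
  variable
    A B : Set

∑-congᴬ : ∀ {k k′ : A → ℕ} {L} → All (λ x → k x ≡ k′ x) L → ∑ L k ≡ ∑ L k′
∑-congᴬ []       = refl
∑-congᴬ (e ∷ es) = cong₂ _+_ e (∑-congᴬ es)

∑-cong : ∀ {k k′ : A → ℕ} L → k ≗ k′ → ∑ L k ≡ ∑ L k′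
∑-cong L e = ∑-congᴬ (universal e L)

∑-zero : (L : List A) → ∑[ x ∈ L ] 0 ≡ 0
∑-zero []      = refl
∑-zero (_ ∷ L) = ∑-zero L

∑-++ : (L M : List A) (k : A → ℕ) → ∑ (L ++ M) k ≡ ∑ L k + ∑ M k
∑-++ []      M k = refl
∑-++ (x ∷ L) M k = trans (cong (k x +_) (∑-++ L M k)) (sym (+-assoc (k x) _ _))

∑-+ : (L : List A) (k k′ : A → ℕ) → ∑[ x ∈ L ] (k x + k′ x) ≡ ∑ L k + ∑ L k′
∑-+ []      k k′ = refl
∑-+ (x ∷ L) k k′ = trans (cong (k x + k′ x +_) (∑-+ L k k′)) (interchange (k x) (k′ x) _ _)

∑-*ˡ : (L : List A) (m : ℕ) (k : A → ℕ) → ∑[ x ∈ L ] (m * k x) ≡ m * ∑ L k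
∑-*ˡ []      m k = sym (*-zeroʳ m)
∑-*ˡ (x ∷ L) m k = trans (cong (m * k x +_) (∑-*ˡ L m k)) (sym (*-distribˡ-+ m (k x) _))

∑-map : (f : B → A) (L : List B) (k : A → ℕ) → ∑ (map f L) k ≡ ∑ L (k ∘ f)
∑-map f []      k = refl
∑-map f (x ∷ L) k = cong (k (f x) +_) (∑-map f L k)

∑-concatMap : (f : B → List A) (L : List B) (k : A → ℕ) →
              ∑ (concatMap f L) k ≡ ∑[ x ∈ L ] ∑ (f x) k
∑-concatMap f []      k = refl
∑-concatMap f (x ∷ L) k = trans (∑-++ (f x) _ k) (cong (∑ (f x) k +_) (∑-concatMap f L k))

∑-swap : (L : List A) (M : List B) (k : A → B → ℕ) →
         ∑[ x ∈ L ] ∑[ y ∈ M ] k x y ≡ ∑[ y ∈ M ] ∑[ x ∈ L ] k x y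
∑-swap []      M k = sym (∑-zero M)
∑-swap (x ∷ L) M k =
  trans (cong (∑ M (k x) +_) (∑-swap L M k)) (sym (∑-+ M (k x) (λ y → ∑[ x ∈ L ] k x y)))

length-filter-false : (p : A → Bool) (L : List A) →
  length (filter (λ x → p x Bool.≟ false) L) ≡ ∑[ x ∈ L ] χ (not (p x))
length-filter-false p []      = refl
length-filter-false p (x ∷ L) with p x
... | true  = length-filter-false p L
... | false = cong suc (length-filter-false p L)

-- Invariance of sums under an involution

Enumerates : {A : Set} {_≈_ : A → A → Set} → Decidable _≈_ → List A → Set
Enumerates {A} _≈?_ L = ∀ (u : A) → ∑[ g ∈ L ] χ (does (g ≈? u)) ≡ 1

module _ (S : Setoid 0ℓ 0ℓ) where
  open Setoid S using (Carrier; _≈_) renaming (sym to ≈-sym; trans to ≈-trans)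

  -- Double counting: a sum over an enumeration is unchanged by precomposing with an
  -- involution φ, since each term k f reappears exactly once as k (φ g) for g ≈ φ f.
  ∑-involution : {_≈?_ : Decidable _≈_} {L : List Carrier} → Enumerates _≈?_ L →
    (φ : Carrier → Carrier) → (∀ f → φ (φ f) ≈ f) → φ Preserves _≈_ ⟶ _≈_ →
    (k : Carrier → ℕ) → k Preserves _≈_ ⟶ _≡_ → ∑ L k ≡ ∑ L (k ∘ φ)
  ∑-involution {_≈?_} {L} enum φ φ-inv φ-cong k k-cong = begin
    ∑[ f ∈ L ] k f                                      ≡⟨ ∑-cong L (λ f → sym (pick (φ f) (k f))) ⟩
    ∑[ f ∈ L ] ∑[ g ∈ L ] k f * χ (does (g ≈? φ f))     ≡⟨ ∑-swap L L _ ⟩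
    ∑[ g ∈ L ] ∑[ f ∈ L ] k f * χ (does (g ≈? φ f))     ≡⟨ ∑-cong L (λ g → ∑-cong L (λ f → exchange f g)) ⟩
    ∑[ g ∈ L ] ∑[ f ∈ L ] k (φ g) * χ (does (f ≈? φ g)) ≡⟨ ∑-cong L (λ g → pick (φ g) (k (φ g))) ⟩
    ∑[ g ∈ L ] k (φ g)                                  ∎
    where
    open ≡-Reasoning

    pick : ∀ u m → ∑[ g ∈ L ] m * χ (does (g ≈? u)) ≡ m
    pick u m = trans (∑-*ˡ L m _) (trans (cong (m *_) (enum u)) (*-identityʳ m))

    flip : ∀ {f g} → g ≈ φ f → f ≈ φ g
    flip {f} e = ≈-trans (≈-sym (φ-inv f)) (φ-cong (≈-sym e))

    exchange : ∀ f g → k f * χ (does (g ≈? φ f)) ≡ k (φ g) * χ (does (f ≈? φ g))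
    exchange f g with g ≈? φ f | f ≈? φ g
    ... | yes _ | yes e  = cong (_* 1) (k-cong e)
    ... | yes e | no ¬e  = ⊥-elim (¬e (flip e))
    ... | no ¬e | yes e  = ⊥-elim (¬e (flip e))
    ... | no _  | no _   = trans (*-zeroʳ (k f)) (sym (*-zeroʳ (k (φ g))))

∑-allFin-suc : ∀ {c} (k : Fin (suc c) → ℕ) → ∑ (allFin (suc c)) k ≡ k zero + ∑ (allFin c) (k ∘ suc)
∑-allFin-suc {c} k =
  cong (k zero +_) (trans (cong (λ L → ∑ L k) (sym (map-tabulate id suc))) (∑-map suc (allFin c) k))

allFin-enumerates : ∀ {c} → Enumerates _≟_ (allFin c)
allFin-enumerates {suc c} zero    = trans (∑-allFin-suc {c} (λ x → χ (does (x ≟ zero)))) (cong suc (∑-zero (allFin c)))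
allFin-enumerates {suc c} (suc y) = trans (∑-allFin-suc {c} (λ x → χ (does (x ≟ suc y)))) (allFin-enumerates y)

module _ {A : Set} (_≟ᴬ_ : DecidableEquality A) where

  _≗?_ : ∀ {n} → Decidable (Setoid._≈_ (Fin n →-setoid A))
  f ≗? g = all? (λ i → f i ≟ᴬ g i)

  funs-enumerates : ∀ {xs} → Enumerates _≟ᴬ_ xs → ∀ n → Enumerates _≗?_ (funs xs n)
  funs-enumerates enum zero    u = cong (λ b → χ b + 0) (dec-true ((λ ()) ≗? u) (λ ()))
  funs-enumerates {xs} enum (suc n) u = begin
    ∑[ g ∈ concatMap (λ x → map (cons x) (funs xs n)) xs ] χ (does (g ≗? u))
      ≡⟨ ∑-concatMap _ xs _ ⟩
    ∑[ x ∈ xs ] ∑[ g ∈ map (cons x) (funs xs n) ] χ (does (g ≗? u))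
      ≡⟨ ∑-cong xs (λ x → ∑-map (cons x) (funs xs n) _) ⟩
    ∑[ x ∈ xs ] ∑[ g ∈ funs xs n ] χ (does (cons x g ≗? u))
      ≡⟨ ∑-cong xs (λ x → ∑-cong (funs xs n) (cons-test x)) ⟩
    ∑[ x ∈ xs ] ∑[ g ∈ funs xs n ] χ (does (x ≟ᴬ u zero)) * χ (does (g ≗? (u ∘ suc)))
      ≡⟨ ∑-cong xs (λ x → ∑-*ˡ (funs xs n) (χ (does (x ≟ᴬ u zero))) _) ⟩
    ∑[ x ∈ xs ] χ (does (x ≟ᴬ u zero)) * (∑[ g ∈ funs xs n ] χ (does (g ≗? (u ∘ suc))))
      ≡⟨ ∑-cong xs (λ x → trans (cong (χ (does (x ≟ᴬ u zero)) *_) (funs-enumerates {xs} enum n (u ∘ suc)))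
                                (*-identityʳ _)) ⟩
    ∑[ x ∈ xs ] χ (does (x ≟ᴬ u zero))
      ≡⟨ enum (u zero) ⟩
    1 ∎
    where
    open ≡-Reasoning

    cons-test : ∀ x g → χ (does (cons x g ≗? u)) ≡ χ (does (x ≟ᴬ u zero)) * χ (does (g ≗? (u ∘ suc)))
    cons-test x g = trans (cong χ (does-⇔ (⇔-sym ∀-cons-⇔) (cons x g ≗? u)
                                          ((x ≟ᴬ u zero) ×-dec (g ≗? (u ∘ suc)))))
                          (χ-∧ (does (x ≟ᴬ u zero)) _)

transpose-comm : ∀ {c} (i j k : Fin c) → transpose i j k ≡ transpose j i k
transpose-comm i j k with k ≟ i | k ≟ j
... | yes refl | yes refl = refl
... | yes refl | no _     rewrite dec-true (k ≟ k) refl = refl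
... | no _     | yes refl rewrite dec-true (k ≟ k) refl = refl
... | no k≢i   | no k≢j   rewrite dec-false (k ≟ i) k≢i | dec-false (k ≟ j) k≢j = refl

transpose-matchˡ : ∀ {c} (i j : Fin c) → transpose i j i ≡ j
transpose-matchˡ i j rewrite dec-true (i ≟ i) refl = refl

transpose-matchʳ : ∀ {c} (i j : Fin c) → transpose i j j ≡ i
transpose-matchʳ i j = trans (transpose-comm i j j) (transpose-matchˡ j i)

transpose-involutive : ∀ {c} (i j k : Fin c) → transpose i j (transpose i j k) ≡ k
transpose-involutive i j k = trans (cong (transpose i j) (transpose-comm i j k)) (transpose-inverse i j)

any-cong : {p q : A → Bool} → p ≗ q → (xs : List A) → any p xs ≡ any q xs
any-cong e xs = cong or (map-cong e xs)

any-allFin : ∀ {n} {P : Fin n → Set} (P? : ∀ i → Dec (P i)) →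
             any (does ∘ P?) (allFin n) ≡ does (any? P?)
any-allFin {zero}  P? = refl
any-allFin {suc n} P? = cong (does (P? zero) ∨_) (begin
  or (map (does ∘ P?) (tabulate suc))          ≡⟨ cong or (map-tabulate suc (does ∘ P?)) ⟩
  or (tabulate (does ∘ P? ∘ suc))              ≡⟨ cong or (map-tabulate id (does ∘ P? ∘ suc)) ⟨
  any (does ∘ P? ∘ suc) (allFin n)             ≡⟨ any-allFin (P? ∘ suc) ⟩
  does (any? (P? ∘ suc))                       ∎)
  where open ≡-Reasoning

EqContains : ∀ {n c} → ColPart n c → Fin c → Fin c → Set
EqContains π a d = ∃₂ λ x y → x < y × T (rel π x y) × color π x ≡ a × color π y ≡ d

eqContains? : ∀ {n c} (π : ColPart n c) (a d : Fin c) → Dec (EqContains π a d)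
eqContains? π a d = any? λ x → any? λ y →
  x <? y ×-dec T? (rel π x y) ×-dec color π x ≟ a ×-dec color π y ≟ d

eqContains-does : ∀ {n c} (π : ColPart n c) (a d : Fin c) →
                  eqContains11ᵇ a d π ≡ does (eqContains? π a d)
eqContains-does {n} π a d =
  trans (any-cong (λ x → trans (any-cong (test-does x) (allFin n)) (any-allFin (Q? x))) (allFin n))
        (any-allFin (λ x → any? (Q? x)))
  where
  Q? : ∀ x y → Dec (x < y × T (rel π x y) × color π x ≡ a × color π y ≡ d)
  Q? x y = x <? y ×-dec T? (rel π x y) ×-dec color π x ≟ a ×-dec color π y ≟ d

  test-does : ∀ x y → ⌊ x <? y ⌋ ∧ rel π x y ∧ ⌊ color π x ≟ a ⌋ ∧ ⌊ color π y ≟ d ⌋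
                    ≡ does (x <? y) ∧ rel π x y ∧ does (color π x ≟ a) ∧ does (color π y ≟ d)
  test-does x y rewrite isYes≗does (x <? y) | isYes≗does (color π x ≟ a)
                      | isYes≗does (color π y ≟ d) = refl

eqContains-cong : ∀ {n c} {π π′ : ColPart n c} {a d a′ d′ : Fin c} →
  EqContains π a d ⇔ EqContains π′ a′ d′ → eqContains11ᵇ a d π ≡ eqContains11ᵇ a′ d′ π′
eqContains-cong {π = π} {π′} {a} {d} {a′} {d′} e =
  trans (eqContains-does π a d)
        (trans (does-⇔ e (eqContains? π a d) (eqContains? π′ a′ d′)) (sym (eqContains-does π′ a′ d′)))

avoids : ∀ {n c} → Rel n → (a d : Fin c) → (Fin n → Fin c) → ℕ
avoids R a d col = χ (not (eqContains11ᵇ a d (colpart R col)))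

avoidingColorings : ∀ {n} c → Rel n → (a d : Fin c) → ℕ
avoidingColorings {n} c R a d = ∑[ col ∈ funs (allFin c) n ] avoids R a d col

-- The recoloring involution on the colorings of a fixed partition

module Recoloring {n c : ℕ} (R : Rel n)
  (R-trans : ∀ {x y z} → T (R x y) → T (R y z) → T (R x z)) (a b : Fin c) where

  Coloring : Set
  Coloring = Fin n → Fin c

  Witnessed : Coloring → Fin n → Set
  Witnessed col y = ∃ λ x → x < y × T (R x y) × col x ≡ a

  witnessed? : ∀ col y → Dec (Witnessed col y)
  witnessed? col y = any? λ x → x <? y ×-dec T? (R x y) ×-dec col x ≟ a

  swap : Fin c → Fin c
  swap = transpose a b

  recolor : Coloring → Coloring
  recolor col y = if does (witnessed? col y) then swap (col y) else col y

  recolor-witnessed : ∀ {col y} → Witnessed col y → recolor col y ≡ swap (col y)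
  recolor-witnessed {col} {y} w rewrite dec-true (witnessed? col y) w = refl

  recolor-unwitnessed : ∀ {col y} → ¬ Witnessed col y → recolor col y ≡ col y
  recolor-unwitnessed {col} {y} ¬w rewrite dec-false (witnessed? col y) ¬w = refl

  witnessed-cong : ∀ {col col′ y} → col ≗ col′ → Witnessed col y → Witnessed col′ y
  witnessed-cong e (x , x<y , xRy , cx) = x , x<y , xRy , trans (sym (e x)) cx

  recolor-cong : ∀ {col col′} → col ≗ col′ → recolor col ≗ recolor col′
  recolor-cong {col} {col′} e y =
    cong₂ (λ w z → if w then swap z else z)
          (does-⇔ (mk⇔ (witnessed-cong e) (witnessed-cong (sym ∘ e)))
                  (witnessed? col y) (witnessed? col′ y))
          (e y)

  -- An a-colored x before y in its block makes y witnessed after recoloring: follow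
  -- witnesses down to the first a-colored element of the block, which is unwitnessed
  -- and so keeps the color a.
  witnessed-forward : ∀ {col x y} → x < y → T (R x y) → col x ≡ a → Witnessed (recolor col) y
  witnessed-forward {col} {x} {y} = descend x (<-wellFounded x)
    where
    descend : ∀ x → Acc _<_ x → x < y → T (R x y) → col x ≡ a → Witnessed (recolor col) y
    descend x (acc smaller) x<y xRy cx with toSum (witnessed? col x)
    ... | inj₁ (x′ , x′<x , x′Rx , cx′) =
      descend x′ (smaller x′<x) (<-trans x′<x x<y) (R-trans x′Rx xRy) cx′
    ... | inj₂ ¬w = x , x<y , xRy , trans (recolor-unwitnessed ¬w) cx

  -- An x before y in its block that is recolored to a makes y witnessed already: either
  -- x was unwitnessed and colored a, or a witness of x also witnesses y.
  witnessed-backward : ∀ {col x y} → x < y → T (R x y) → recolor col x ≡ a → Witnessed col y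
  witnessed-backward {col} {x} x<y xRy rx with toSum (witnessed? col x)
  ... | inj₁ (x′ , x′<x , x′Rx , cx′) = x′ , <-trans x′<x x<y , R-trans x′Rx xRy , cx′
  ... | inj₂ ¬w = x , x<y , xRy , trans (sym (recolor-unwitnessed ¬w)) rx

  witnessed-recolor : ∀ {col y} → Witnessed (recolor col) y ⇔ Witnessed col y
  witnessed-recolor = mk⇔ (λ (_ , x<y , xRy , rx) → witnessed-backward x<y xRy rx)
                          (λ (_ , x<y , xRy , cx) → witnessed-forward x<y xRy cx)

  recolor-involutive : ∀ col → recolor (recolor col) ≗ col
  recolor-involutive col y with toSum (witnessed? col y)
  ... | inj₁ w = begin
    recolor (recolor col) y  ≡⟨ recolor-witnessed (from witnessed-recolor w) ⟩
    swap (recolor col y)     ≡⟨ cong swap (recolor-witnessed w) ⟩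
    swap (swap (col y))      ≡⟨ transpose-involutive a b (col y) ⟩
    col y                    ∎
    where open ≡-Reasoning
  ... | inj₂ ¬w = trans (recolor-unwitnessed (¬w ∘ to witnessed-recolor)) (recolor-unwitnessed ¬w)

  Contains : Fin c → Coloring → Set
  Contains d col = EqContains (colpart R col) a d

  contains-cong : ∀ {d col col′} → col ≗ col′ → Contains d col → Contains d col′
  contains-cong e (x , y , x<y , xRy , cx , cy) = x , y , x<y , xRy , trans (sym (e x)) cx , trans (sym (e y)) cy

  -- In an occurrence x < y of 1^a 1^d in the recoloring, y is witnessed, so the
  -- original coloring has the occurrence x′ < y of 1^a 1^(swap d) for a witness x′.
  contains-recolor : ∀ {d col} → Contains d (recolor col) → Contains (swap d) col
  contains-recolor {d} {col} (x , y , x<y , xRy , rx , ry)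
    with witnessed-backward x<y xRy rx
  ... | w@(x′ , x′<y , x′Ry , cx′) = x′ , y , x′<y , x′Ry , cx′ , (begin
    col y                    ≡⟨ transpose-involutive a b (col y) ⟨
    swap (swap (col y))      ≡⟨ cong swap (recolor-witnessed w) ⟨
    swap (recolor col y)     ≡⟨ cong swap ry ⟩
    swap d                   ∎)
    where open ≡-Reasoning

  contains-aa⇔ab : ∀ col → Contains a col ⇔ Contains b (recolor col)
  contains-aa⇔ab col = mk⇔
    (λ h → subst (λ d → Contains d (recolor col)) (transpose-matchˡ a b)
                 (contains-recolor (contains-cong (sym ∘ recolor-involutive col) h)))
    (λ h → subst (λ d → Contains d col) (transpose-matchʳ a b) (contains-recolor h))

  avoids-cong : ∀ d {col col′} → col ≗ col′ → avoids R a d col ≡ avoids R a d col′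
  avoids-cong d e = cong (χ ∘ not) (eqContains-cong (mk⇔ (contains-cong e) (contains-cong (sym ∘ e))))

  avoid-counts-agree : avoidingColorings c R a a ≡ avoidingColorings c R a b
  avoid-counts-agree = begin
    ∑[ col ∈ colorings ] avoids R a a col            ≡⟨ ∑-cong colorings (λ col → cong (χ ∘ not) (eqContains-cong (contains-aa⇔ab col))) ⟩
    ∑[ col ∈ colorings ] avoids R a b (recolor col)  ≡⟨ ∑-involution (Fin n →-setoid Fin c) {_≗?_ _≟_} {colorings} enumerates
                                                          recolor recolor-involutive recolor-cong (avoids R a b) (avoids-cong b) ⟨
    ∑[ col ∈ colorings ] avoids R a b col            ∎
    where
    open ≡-Reasoning
    colorings : List Coloring
    colorings = funs (allFin c) n
    enumerates : Enumerates (_≗?_ _≟_) colorings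
    enumerates = funs-enumerates _≟_ allFin-enumerates n

all-allFin : ∀ {n} (p : Fin n → Bool) → T (all p (allFin n)) → ∀ i → T (p i)
all-allFin {n} p h i = All.lookup (all⁺ p (allFin n) h) (∈-allFin i)

⇒ᵇ-elim : ∀ {x y} → T (x ⇒ᵇ y) → T x → T y
⇒ᵇ-elim {true} h _ = h

isEquiv⇒transitive : ∀ {n} {R : Rel n} → isEquivᵇ R ≡ true →
                     ∀ {x y z} → T (R x y) → T (R y z) → T (R x z)
isEquiv⇒transitive {n} {R} isEq {x} {y} {z} xRy yRz =
  ⇒ᵇ-elim (all-allFin _ (all-allFin _ (all-allFin _ transitive x) y) z) (from T-∧ (xRy , yRz))
  where
  reflexiveᵇ symmetricᵇ transitiveᵇ : Bool
  reflexiveᵇ  = all (λ i → R i i) (allFin n)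
  symmetricᵇ  = all (λ i → all (λ j → R i j ⇒ᵇ R j i) (allFin n)) (allFin n)
  transitiveᵇ = all (λ i → all (λ j → all (λ k → (R i j ∧ R j k) ⇒ᵇ R i k) (allFin n)) (allFin n)) (allFin n)
  transitive : T transitiveᵇ
  transitive = proj₂ (to (T-∧ {symmetricᵇ}) (proj₂ (to (T-∧ {reflexiveᵇ}) (from T-≡ isEq))))

partitions : (n : ℕ) → List (Rel n)
partitions n = filter (λ R → isEquivᵇ R Bool.≟ true) (allRels n)

avoidCount-as-sum : ∀ n c (a d : Fin c) →
  avoidCount n c a d ≡ ∑[ R ∈ partitions n ] avoidingColorings c R a d
avoidCount-as-sum n c a d = begin
  avoidCount n c a d                                           ≡⟨ length-filter-false (eqContains11ᵇ a d) (allColParts n c) ⟩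
  ∑ (allColParts n c) avoiding                                 ≡⟨ ∑-concatMap _ (partitions n) avoiding ⟩
  ∑[ R ∈ partitions n ] ∑ (map (colpart R) colorings) avoiding ≡⟨ ∑-cong (partitions n) (λ R → ∑-map (colpart R) colorings avoiding) ⟩
  ∑[ R ∈ partitions n ] avoidingColorings c R a d              ∎
  where
  open ≡-Reasoning
  colorings : List (Fin n → Fin c)
  colorings = funs (allFin c) n
  avoiding : ColPart n c → ℕ
  avoiding π = χ (not (eqContains11ᵇ a d π))

theorem2p2 : (n c : ℕ) → 2 ≤ c → (a b : Fin c) → a ≢ b →
    avoidCount n c a a ≡ avoidCount n c a b
theorem2p2 n c _ a b _ = begin
  avoidCount n c a a                               ≡⟨ avoidCount-as-sum n c a a ⟩
  ∑[ R ∈ partitions n ] avoidingColorings c R a a  ≡⟨ ∑-congᴬ (All.map (λ {R} → agree {R}) (all-filter _ (allRels n))) ⟩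
  ∑[ R ∈ partitions n ] avoidingColorings c R a b  ≡⟨ avoidCount-as-sum n c a b ⟨
  avoidCount n c a b                               ∎
  where
  open ≡-Reasoning
  agree : ∀ {R : Rel n} → isEquivᵇ R ≡ true → avoidingColorings c R a a ≡ avoidingColorings c R a b
  agree {R} isEq = Recoloring.avoid-counts-agree R (isEquiv⇒transitive {R = R} isEq) a b
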